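{- Let $k \ge 3$ and let $G$ be a $(k+1)$-critical graph with minimum degree $\delta(G)=k$. Let $v$ be a vertex of degree $k$ in $G$ with neighbors $v_1,\ldots,v_k$, and let $\varphi$ be a proper $k$-coloring of $G-v$ with colors $[k]=\{1,\ldots,k\}$ satisfying $\varphi(v_i)=i$ for all $i$. Let $\sigma$ be a cyclic permutation of $r$ distinct elements of $[k]$ (for some $3\le r\le k$). Then for each color $i$ appearing in $\sigma$, the $\sigma$-subdigraph of $G-v$ under $\varphi$ contains a directed path from $v_i$ to $v_{\sigma^{ -1}(i)}$.
   Context: A graph is $(k+1)$-critical if its chromatic number is $k+1$ but every proper subgraph has chromatic number at most $k$. Given a graph $H$ with a proper coloring $\varphi:V(H)\to[k]$ and a cyclic permutation $\sigma$ of $r$ distinct elements of $[k]$ (an $r$-cycle $c_1\to c_2\to\cdots\to c_r\to c_1$ on colors), the $\sigma$-subdigraph $D_\sigma$ of $H$ under $\varphi$ is the directed graph with vertex set $V(H)$ having an arc $u\to w$ if and only if $uw\in E(H)$, $\varphi(u)$ is one of the colors of $\sigma$, and $\sigma(\varphi(u))=\varphi(w)$. -}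

module Defs where

open import Data.Nat using (ℕ; zero; suc; _+_; _≤_; _<_)
open import Data.Nat.DivMod using (_%_; m%n<n)
open import Data.Fin using (Fin; toℕ; fromℕ<)
open import Data.Bool using (Bool; true; false)
open import Data.List using (List; []; _∷_; _++_; length; filterᵇ; allFin)
open import Data.List.Relation.Unary.Linked using (Linked)
open import Data.List.Relation.Unary.Unique.Propositional using (Unique)
open import Data.Product using (Σ; ∃; _×_; _,_)
open import Data.Sum using (_⊎_)
open import Relation.Binary.PropositionalEquality using (_≡_; _≢_)
open import Relation.Nullary using (¬_)

record Graph : Set where
  field
    n      : ℕ
    adj    : Fin n → Fin n → Bool
    sym    : ∀ u w → adj u w ≡ adj w u
    irrefl : ∀ u → adj u u ≡ false

open Graph public

Edge : (G : Graph) → Fin (n G) → Fin (n G) → Set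
Edge G u w = adj G u w ≡ true

Colorable : Graph → ℕ → Set
Colorable G k = Σ (Fin (n G) → Fin k) λ c → ∀ u w → Edge G u w → c u ≢ c w

record Subgraph (G : Graph) : Set where
  field
    S    : Fin (n G) → Bool
    E    : Fin (n G) → Fin (n G) → Bool
    Esym : ∀ u w → E u w ≡ E w u
    E⊆   : ∀ u w → E u w ≡ true → adj G u w ≡ true
    Eend : ∀ u w → E u w ≡ true → S u ≡ true × S w ≡ true

open Subgraph public

ProperSub : {G : Graph} → Subgraph G → Set
ProperSub {G} H =
  (∃ λ u → S H u ≡ false) ⊎ (∃ λ u → ∃ λ w → adj G u w ≡ true × E H u w ≡ false)

SubColorable : {G : Graph} → Subgraph G → ℕ → Set
SubColorable {G} H k =
  Σ (Fin (n G) → Fin k) λ c → ∀ u w → E H u w ≡ true → c u ≢ c w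

Critical : Graph → ℕ → Set
Critical G k =
  Colorable G (suc k) × ¬ Colorable G k ×
  (∀ (H : Subgraph G) → ProperSub H → SubColorable H k)

deg : (G : Graph) → Fin (n G) → ℕ
deg G v = length (filterᵇ (adj G v) (allFin (n G)))

MinDegreeEq : Graph → ℕ → Set
MinDegreeEq G k = (∀ v → k ≤ deg G v) × (∃ λ v → deg G v ≡ k)

cnext : ∀ {r} → Fin r → Fin r
cnext {suc m} i = fromℕ< (m%n<n (suc (toℕ i)) (suc m))

cprev : ∀ {r} → Fin r → Fin r
cprev {suc m} i = fromℕ< (m%n<n (m + toℕ i) (suc m))

-- The σ-subdigraph of G − v under φ, where σ is the r-cycle
-- c 0 → c 1 → ... → c (r-1) → c 0 on colors (c injective).
-- Arc u → w iff u, w ≠ v, uw ∈ E(G), φ(u) = c j and φ(w) = c (j+1 mod r).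
SigmaArc : (G : Graph) (v : Fin (n G)) {k r : ℕ} (φ : Fin (n G) → Fin k)
           (c : Fin r → Fin k) → Fin (n G) → Fin (n G) → Set
SigmaArc G v φ c u w =
  u ≢ v × w ≢ v × Edge G u w × (∃ λ j → φ u ≡ c j × φ w ≡ c (cnext j))

DiPath : {V : Set} → (V → V → Set) → V → V → Set
DiPath {V} Arc x y =
  Σ (List V) λ ws → Linked Arc (x ∷ ws ++ y ∷ []) × Unique (x ∷ ws ++ y ∷ [])

-- Let X be the set of vertices reachable from v_i in D_σ. If v_{σ⁻¹(i)} ∉ X, recolour
-- G: every u ∈ X gets σ(φ(u)), every other vertex of G − v keeps φ(u), and v gets
-- colour i. Within X the colouring stays proper because σ is a permutation; an edge
-- from X to the outside whose colours now clash would be an arc of D_σ leaving X.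
-- Since deg v = k, the neighbours of v are exactly v_1, …, v_k, and the only ones
-- that could now have colour i are v_i (if outside X) or v_{σ⁻¹(i)} (if inside X);
-- neither happens. So G would be k-colourable, which it is not.
module Submission where

open import Defs hiding (sym)
open import Data.Nat using (ℕ; zero; suc; _+_; _≤_; _<_; NonZero; s≤s; s≤s⁻¹)
open import Data.Nat.Properties
  using (+-comm; +-suc; +-identityʳ; ≤-refl; ≤-trans; <-trans; <-≤-trans; n<1+n; n≤1+n; n≮n; 1+n≢0; 1+n≢n)
open import Data.Nat.DivMod using (_%_; %-distribˡ-+; m%n%n≡m%n; [m+n]%n≡m%n; m<n⇒m%n≡m)
open import Data.Fin using (Fin; zero; suc; toℕ; _≟_)
open import Data.Fin.Properties using (toℕ-fromℕ<; toℕ-injective; toℕ<n; any?; injective⇒≤)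
open import Data.Bool using (true)
import Data.Bool.Properties as Bool
open import Data.List using (List; []; _∷_; _++_; _∷ʳ_; length; filter; filterᵇ; allFin)
open import Data.List.Properties using (filter-notAll)
open import Data.List.Relation.Unary.All as All using (All; []; _∷_)
import Data.List.Relation.Unary.All.Properties as All
open import Data.List.Relation.Unary.Any as Any using (here; there)
open import Data.List.Relation.Unary.Linked using (Linked; [-]; _∷_)
open import Data.List.Relation.Unary.AllPairs using ([]; _∷_)
import Data.List.Relation.Unary.Unique.Propositional.Properties as Unique
open import Data.List.Membership.Propositional using (_∈_; _∉_)
open import Data.List.Membership.Propositional.Properties using (∈-filter⁺; ∈-allFin)
open import Data.List.Membership.Setoid.Properties using (index-injective)
import Data.Vec.Functional as Vector
open import Data.Product using (∃; _×_; _,_; proj₁)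
import Data.Product as Product
open import Data.Sum using (_⊎_; inj₁; inj₂)
import Data.Sum as Sum
open import Data.Empty using (⊥-elim)
open import Function using (_∘_; Equivalence)
open import Function.Definitions using (Injective)
open import Relation.Nullary using (¬_; Dec; yes; no; contradiction)
open import Relation.Nullary.Decidable using (_×-dec_; ¬?; T?; decidable-stable)
open import Relation.Binary.PropositionalEquality
  using (_≡_; _≢_; refl; sym; trans; cong; subst; setoid; module ≡-Reasoning)

open ≡-Reasoning

[m+n%d]%d≡[m+n]%d : ∀ m n d .{{_ : NonZero d}} → (m + n % d) % d ≡ (m + n) % d
[m+n%d]%d≡[m+n]%d m n d = begin
  (m + n % d) % d            ≡⟨ %-distribˡ-+ m (n % d) d ⟩
  (m % d + n % d % d) % d    ≡⟨ cong (λ t → (m % d + t) % d) (m%n%n≡m%n n d) ⟩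
  (m % d + n % d) % d        ≡⟨ %-distribˡ-+ m n d ⟨
  (m + n) % d                ∎

suc[m+t]%suc[m]≡t : ∀ {m t} → t < suc m → suc (m + t) % suc m ≡ t
suc[m+t]%suc[m]≡t {m} {t} t<1+m = begin
  suc (m + t) % suc m  ≡⟨ cong (_% suc m) (+-comm (suc m) t) ⟩
  (t + suc m) % suc m  ≡⟨ [m+n]%n≡m%n t (suc m) ⟩
  t % suc m            ≡⟨ m<n⇒m%n≡m t<1+m ⟩
  t                    ∎

cprev-cnext : ∀ {r} (i : Fin r) → cprev (cnext i) ≡ i
cprev-cnext {suc m} i = toℕ-injective (begin
  toℕ (cprev (cnext i))              ≡⟨ toℕ-fromℕ< _ ⟩
  (m + toℕ (cnext i)) % suc m        ≡⟨ cong (λ t → (m + t) % suc m) (toℕ-fromℕ< _) ⟩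
  (m + suc (toℕ i) % suc m) % suc m  ≡⟨ [m+n%d]%d≡[m+n]%d m (suc (toℕ i)) (suc m) ⟩
  (m + suc (toℕ i)) % suc m          ≡⟨ cong (_% suc m) (+-suc m (toℕ i)) ⟩
  suc (m + toℕ i) % suc m            ≡⟨ suc[m+t]%suc[m]≡t (toℕ<n i) ⟩
  toℕ i                              ∎)

cnext-cprev : ∀ {r} (i : Fin r) → cnext (cprev i) ≡ i
cnext-cprev {suc m} i = toℕ-injective (begin
  toℕ (cnext (cprev i))              ≡⟨ toℕ-fromℕ< _ ⟩
  suc (toℕ (cprev i)) % suc m        ≡⟨ cong (λ t → suc t % suc m) (toℕ-fromℕ< _) ⟩
  (1 + (m + toℕ i) % suc m) % suc m  ≡⟨ [m+n%d]%d≡[m+n]%d 1 (m + toℕ i) (suc m) ⟩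
  suc (m + toℕ i) % suc m            ≡⟨ suc[m+t]%suc[m]≡t (toℕ<n i) ⟩
  toℕ i                              ∎)

cnext-injective : ∀ {r} → Injective _≡_ _≡_ (cnext {r})
cnext-injective {x = i} {y = j} eq = begin
  i                ≡⟨ cprev-cnext i ⟨
  cprev (cnext i)  ≡⟨ cong cprev eq ⟩
  cprev (cnext j)  ≡⟨ cprev-cnext j ⟩
  j                ∎

cprev-≢ : ∀ {r} → 2 ≤ r → (i : Fin r) → cprev i ≢ i
cprev-≢ {suc zero}    (s≤s ()) _
cprev-≢ {suc (suc m)} _ i eq =
  no-fixed-point (toℕ i) (toℕ<n i) (trans (sym (toℕ-fromℕ< _)) (cong toℕ eq))
  where
  no-fixed-point : ∀ t → t < suc (suc m) → (suc m + t) % suc (suc m) ≢ t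
  no-fixed-point zero _ eq₀ = 1+n≢0 (begin
    suc m                       ≡⟨ m<n⇒m%n≡m (n<1+n (suc m)) ⟨
    suc m % suc (suc m)         ≡⟨ cong (_% suc (suc m)) (+-identityʳ (suc m)) ⟨
    (suc m + 0) % suc (suc m)   ≡⟨ eq₀ ⟩
    0                           ∎)
  no-fixed-point (suc t) 1+t<2+m eqₛ = 1+n≢n (sym (begin
    t                               ≡⟨ suc[m+t]%suc[m]≡t (<-trans (n<1+n t) 1+t<2+m) ⟨
    suc (suc m + t) % suc (suc m)   ≡⟨ cong (_% suc (suc m)) (+-suc (suc m) t) ⟨
    (suc m + suc t) % suc (suc m)   ≡⟨ eqₛ ⟩
    suc t                           ∎))

module Rotation {k r : ℕ} (c : Fin r → Fin k) (c-injective : Injective _≡_ _≡_ c) where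

  rotate : Fin k → Fin k
  rotate a with any? (λ i → c i ≟ a)
  ... | yes (i , _) = c (cnext i)
  ... | no _        = a

  rotate-view : ∀ a → (∃ λ i → c i ≡ a × rotate a ≡ c (cnext i)) ⊎ ((∀ i → c i ≢ a) × rotate a ≡ a)
  rotate-view a with any? (λ i → c i ≟ a)
  ... | yes (i , ci≡a) = inj₁ (i , ci≡a , refl)
  ... | no ∄i          = inj₂ ((λ i ci≡a → ∄i (i , ci≡a)) , refl)

  rotate-c : ∀ i → rotate (c i) ≡ c (cnext i)
  rotate-c i with rotate-view (c i)
  ... | inj₁ (i′ , ci′≡ci , eq) = trans eq (cong (c ∘ cnext) (c-injective ci′≡ci))
  ... | inj₂ (off , _)          = ⊥-elim (off i refl)

  rotate-injective : Injective _≡_ _≡_ rotate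
  rotate-injective {a} {b} eq with rotate-view a | rotate-view b
  ... | inj₁ (i , refl , ra) | inj₁ (i′ , refl , rb) =
    cong c (cnext-injective (c-injective (trans (sym ra) (trans eq rb))))
  ... | inj₁ (i , refl , ra) | inj₂ (off , rb) = ⊥-elim (off (cnext i) (trans (sym ra) (trans eq rb)))
  ... | inj₂ (off , ra) | inj₁ (i′ , refl , rb) = ⊥-elim (off (cnext i′) (trans (sym rb) (trans (sym eq) ra)))
  ... | inj₂ (_ , ra) | inj₂ (_ , rb) = trans (sym ra) (trans eq rb)

  rotate⁻¹-c : ∀ {a i} → rotate a ≡ c i → a ≡ c (cprev i)
  rotate⁻¹-c {a} {i} eq = rotate-injective (begin
    rotate a                 ≡⟨ eq ⟩
    c i                      ≡⟨ cong c (cnext-cprev i) ⟨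
    c (cnext (cprev i))      ≡⟨ rotate-c (cprev i) ⟨
    rotate (c (cprev i))     ∎)

linked-∷ʳ⁺ : ∀ {A : Set} {R : A → A → Set} xs {a b} →
             Linked R (xs ∷ʳ a) → R a b → Linked R (xs ∷ʳ a ∷ʳ b)
linked-∷ʳ⁺ []           _          Rab = Rab ∷ [-]
linked-∷ʳ⁺ (x ∷ [])     (Rxa ∷ _)  Rab = Rxa ∷ Rab ∷ [-]
linked-∷ʳ⁺ (x ∷ y ∷ xs) (Rxy ∷ ys) Rab = Rxy ∷ linked-∷ʳ⁺ (y ∷ xs) ys Rab

module _ {V : Set} {Arc : V → V → Set} {x : V} where

  diPath-arc : ∀ {w} → Arc x w → x ≢ w → DiPath Arc x w
  diPath-arc a x≢w = [] , a ∷ [-] , (x≢w ∷ []) ∷ [] ∷ []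

  diPath-∷ʳ : ∀ {u w} (p : DiPath Arc x u) → Arc u w → w ∉ x ∷ proj₁ p ++ u ∷ [] → DiPath Arc x w
  diPath-∷ʳ {u} (ws , linked , unique) a w∉ =
    ws ∷ʳ u , linked-∷ʳ⁺ (x ∷ ws) linked a , Unique.++⁺ unique ([] ∷ []) λ { (w∈ , here refl) → w∉ w∈ }

OutClosed : {V : Set} → (V → V → Set) → List V → Set
OutClosed Arc vs = ∀ {u w} → u ∈ vs → Arc u w → w ∈ vs

-- The search grows a set of vertices, each reached from x by a simple path inside the
-- set, and terminates because a list `unseen` covering the complement shrinks at
-- every step.
module _ {N : ℕ} {Arc : Fin N → Fin N → Set} (arc? : ∀ u w → Dec (Arc u w)) (x : Fin N) where

  open import Data.List.Membership.DecPropositional (_≟_ {N}) using (_∈?_)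

  private
    ReachedWithin : List (Fin N) → Fin N → Set
    ReachedWithin vs u = u ≡ x ⊎ ∃ λ (p : DiPath Arc x u) → All (_∈ vs) (x ∷ proj₁ p ++ u ∷ [])

    Explored : List (Fin N) → Set
    Explored vs = x ∈ vs × (∀ {u} → u ∈ vs → ReachedWithin vs u)

    Escape : List (Fin N) → Set
    Escape vs = ∃ λ u → ∃ λ w → u ∈ vs × w ∉ vs × Arc u w

    escape? : ∀ vs → Dec (Escape vs)
    escape? vs = any? λ u → any? λ w → u ∈? vs ×-dec ¬? (w ∈? vs) ×-dec arc? u w

    outClosed : ∀ vs → ¬ Escape vs → OutClosed Arc vs
    outClosed vs ¬escape {u} {w} u∈ a =
      decidable-stable (w ∈? vs) (λ w∉ → ¬escape (u , w , u∈ , w∉ , a))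

    reached-weaken : ∀ {vs u w} → ReachedWithin vs u → ReachedWithin (w ∷ vs) u
    reached-weaken = Sum.map₂ (Product.map₂ (All.map there))

    reached-step : ∀ {vs u w} → x ∈ vs → ReachedWithin vs u → Arc u w → w ∉ vs → ReachedWithin (w ∷ vs) w
    reached-step x∈ (inj₁ refl) a w∉ =
      inj₂ (diPath-arc a (λ { refl → w∉ x∈ }) , there x∈ ∷ here refl ∷ [])
    reached-step x∈ (inj₂ (p , p⊆)) a w∉ =
      inj₂ (diPath-∷ʳ p a (w∉ ∘ All.lookup p⊆) , All.∷ʳ⁺ (All.map there p⊆) (here refl))

    explore : ∀ {vs u w} → Explored vs → u ∈ vs → Arc u w → w ∉ vs → Explored (w ∷ vs)
    explore (x∈ , reached) u∈ a w∉ = there x∈ , λ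
      { (here refl) → reached-step x∈ (reached u∈) a w∉
      ; (there z∈)  → reached-weaken (reached z∈) }

    close : ∀ fuel vs unseen → length unseen < fuel → (∀ z → z ∈ vs ⊎ z ∈ unseen) →
            Explored vs → ∃ λ vs → Explored vs × OutClosed Arc vs
    close zero       _  _      ()    _      _
    close (suc fuel) vs unseen bound covers explored with escape? vs
    ... | no ¬escape = vs , explored , outClosed vs ¬escape
    ... | yes (u , w , u∈ , w∉ , a) =
      close fuel (w ∷ vs) unseen′ bound′ covers′ (explore explored u∈ a w∉)
      where
      unseen′ : List (Fin N)
      unseen′ = filter (λ z → ¬? (w ≟ z)) unseen

      w∈unseen : w ∈ unseen
      w∈unseen = Sum.fromInj₂ (λ w∈vs → contradiction w∈vs w∉) (covers w)

      bound′ : length unseen′ < fuel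
      bound′ = <-≤-trans (filter-notAll _ unseen (Any.map (λ w≡z w≢z → w≢z w≡z) w∈unseen)) (s≤s⁻¹ bound)

      covers′ : ∀ z → z ∈ w ∷ vs ⊎ z ∈ unseen′
      covers′ z with covers z | w ≟ z
      ... | inj₁ z∈ | _        = inj₁ (there z∈)
      ... | inj₂ _  | yes refl = inj₁ (here refl)
      ... | inj₂ z∈ | no w≢z   = inj₂ (∈-filter⁺ _ z∈ w≢z)

    closure : ∃ λ vs → Explored vs × OutClosed Arc vs
    closure = close (suc (length (allFin N))) (x ∷ []) (allFin N) ≤-refl (inj₂ ∘ ∈-allFin)
                    (here refl , λ { (here refl) → inj₁ refl })

  path-or-cut : ∀ y → x ≢ y → DiPath Arc x y ⊎ ∃ λ vs → x ∈ vs × y ∉ vs × OutClosed Arc vs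
  path-or-cut y x≢y with closure
  ... | vs , (x∈ , reached) , closed with y ∈? vs
  ...   | no y∉ = inj₂ (vs , x∈ , y∉ , closed)
  ...   | yes y∈ with reached y∈
  ...     | inj₁ y≡x     = contradiction (sym y≡x) x≢y
  ...     | inj₂ (p , _) = inj₁ p

edge-sym : ∀ G {u w} → Edge G u w → Edge G w u
edge-sym G {u} {w} e = trans (Graph.sym G w u) e

edge-irrefl : ∀ G {u} → ¬ Edge G u u
edge-irrefl G {u} e = contradiction (trans (sym e) (irrefl G u)) λ ()

sigmaArc? : (G : Graph) (v : Fin (n G)) {k r : ℕ} (φ : Fin (n G) → Fin k) (c : Fin r → Fin k) →
            ∀ u w → Dec (SigmaArc G v φ c u w)
sigmaArc? G v φ c u w =
  ¬? (u ≟ v) ×-dec ¬? (w ≟ v) ×-dec adj G u w Bool.≟ true ×-dec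
  any? λ i → φ u ≟ c i ×-dec φ w ≟ c (cnext i)

injective⇒≤length : ∀ {A : Set} {m} {xs : List A} {f : Fin m → A} →
                    Injective _≡_ _≡_ f → (∀ i → f i ∈ xs) → m ≤ length xs
injective⇒≤length f-injective f∈ =
  injective⇒≤ λ eq → f-injective (index-injective (setoid _) (f∈ _) (f∈ _) eq)

∷-injective : ∀ {A : Set} {m} {a : A} {f : Fin m → A} →
              Injective _≡_ _≡_ f → (∀ i → f i ≢ a) → Injective _≡_ _≡_ (a Vector.∷ f)
∷-injective _ _ {zero}  {zero}  _  = refl
∷-injective _ a∉ {zero}  {suc j} eq = ⊥-elim (a∉ j (sym eq))
∷-injective _ a∉ {suc i} {zero}  eq = ⊥-elim (a∉ i eq)
∷-injective f-injective _ {suc i} {suc j} eq = cong suc (f-injective eq)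

neighbours-of-degree : (G : Graph) (v : Fin (n G)) {k : ℕ} → deg G v ≡ k →
                       (nb : Fin k → Fin (n G)) → Injective _≡_ _≡_ nb → (∀ i → Edge G v (nb i)) →
                       ∀ w → Edge G v w → ∃ λ i → nb i ≡ w
neighbours-of-degree G v refl nb nb-injective nb-adj w vw with any? (λ i → nb i ≟ w)
... | yes found = found
... | no ∄i     = contradiction (injective⇒≤length (∷-injective nb-injective (λ i e → ∄i (i , e))) w∷nb∈)
                                (n≮n (deg G v))
  where
  neighbour∈ : ∀ {u} → Edge G v u → u ∈ filterᵇ (adj G v) (allFin (n G))
  neighbour∈ e = ∈-filter⁺ (T? ∘ adj G v) (∈-allFin _) (Equivalence.from Bool.T-≡ e)

  w∷nb∈ : ∀ i → (w Vector.∷ nb) i ∈ filterᵇ (adj G v) (allFin (n G))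
  w∷nb∈ zero    = neighbour∈ vw
  w∷nb∈ (suc i) = neighbour∈ (nb-adj i)

module Recolouring
  {k : ℕ} (G : Graph) (v : Fin (n G))
  (nb : Fin k → Fin (n G)) (nb-onto : ∀ w → Edge G v w → ∃ λ i → nb i ≡ w)
  (φ : Fin (n G) → Fin k) (φ-proper : ∀ u w → u ≢ v → w ≢ v → Edge G u w → φ u ≢ φ w)
  (φ-nb : ∀ i → φ (nb i) ≡ i)
  {r : ℕ} (c : Fin r → Fin k) (c-injective : Injective _≡_ _≡_ c) (j : Fin r)
  (vs : List (Fin (n G))) (x∈ : nb (c j) ∈ vs) (y∉ : nb (c (cprev j)) ∉ vs)
  (closed : OutClosed (SigmaArc G v φ c) vs)
  where

  open Rotation c c-injective
  open import Data.List.Membership.DecPropositional (_≟_ {n G}) using (_∈?_)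

  rotated : Fin (n G) → Fin k
  rotated u with u ∈? vs
  ... | yes _ = rotate (φ u)
  ... | no _  = φ u

  recoloured : Fin (n G) → Fin k
  recoloured u with u ≟ v
  ... | yes _ = c j
  ... | no _  = rotated u

  rotate-crossing : ∀ {u w} → u ∈ vs → w ∉ vs → u ≢ v → w ≢ v → Edge G u w → rotate (φ u) ≢ φ w
  rotate-crossing {u} {w} u∈ w∉ u≢v w≢v uw eq with rotate-view (φ u)
  ... | inj₁ (i , ci≡φu , rot) = w∉ (closed u∈ (u≢v , w≢v , uw , i , sym ci≡φu , trans (sym eq) rot))
  ... | inj₂ (_ , rot)         = φ-proper u w u≢v w≢v uw (trans (sym rot) eq)

  rotated-proper : ∀ {u w} → u ≢ v → w ≢ v → Edge G u w → rotated u ≢ rotated w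
  rotated-proper {u} {w} u≢v w≢v uw with u ∈? vs | w ∈? vs
  ... | yes _  | yes _  = φ-proper u w u≢v w≢v uw ∘ rotate-injective
  ... | yes u∈ | no w∉  = rotate-crossing u∈ w∉ u≢v w≢v uw
  ... | no u∉  | yes w∈ = rotate-crossing w∈ u∉ w≢v u≢v (edge-sym G uw) ∘ sym
  ... | no _   | no _   = φ-proper u w u≢v w≢v uw

  rotated-neighbour-≢ : ∀ {w} → Edge G v w → rotated w ≢ c j
  rotated-neighbour-≢ {w} vw with nb-onto w vw
  ... | i , refl with nb i ∈? vs
  ...   | yes nb-i∈ = λ eq →
          y∉ (subst (_∈ vs) (cong nb (rotate⁻¹-c (trans (cong rotate (sym (φ-nb i))) eq))) nb-i∈)
  ...   | no nb-i∉ = λ eq → nb-i∉ (subst (_∈ vs) (cong nb (sym (trans (sym (φ-nb i)) eq))) x∈)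

  recoloured-proper : ∀ u w → Edge G u w → recoloured u ≢ recoloured w
  recoloured-proper u w uw with u ≟ v | w ≟ v
  ... | yes refl | yes refl = contradiction uw (edge-irrefl G)
  ... | yes refl | no _     = rotated-neighbour-≢ uw ∘ sym
  ... | no _     | yes refl = rotated-neighbour-≢ (edge-sym G uw)
  ... | no u≢v   | no w≢v   = rotated-proper u≢v w≢v uw

sigma-path : ∀ {k} (G : Graph) → ¬ Colorable G k →
             (v : Fin (n G)) → deg G v ≡ k →
             (nb : Fin k → Fin (n G)) → Injective _≡_ _≡_ nb → (∀ i → Edge G v (nb i)) →
             (φ : Fin (n G) → Fin k) →
             (∀ u w → u ≢ v → w ≢ v → Edge G u w → φ u ≢ φ w) →
             (∀ i → φ (nb i) ≡ i) →
             ∀ {r} → 2 ≤ r → (c : Fin r → Fin k) → Injective _≡_ _≡_ c →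
             (j : Fin r) → DiPath (SigmaArc G v φ c) (nb (c j)) (nb (c (cprev j)))
sigma-path G ¬colorable v deg-v nb nb-injective nb-adj φ φ-proper φ-nb 2≤r c c-injective j
  with path-or-cut (sigmaArc? G v φ c) (nb (c j)) (nb (c (cprev j)))
                   (cprev-≢ 2≤r j ∘ sym ∘ c-injective ∘ nb-injective)
... | inj₁ path = path
... | inj₂ (vs , x∈ , y∉ , closed) = ⊥-elim (¬colorable (recoloured , recoloured-proper))
  where
  open Recolouring G v nb (neighbours-of-degree G v deg-v nb nb-injective nb-adj)
                   φ φ-proper φ-nb c c-injective j vs x∈ y∉ closed

lemma1 : (k : ℕ) → 3 ≤ k → (G : Graph) → Critical G k → MinDegreeEq G k →
         (v : Fin (n G)) → deg G v ≡ k →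
         (nb : Fin k → Fin (n G)) → Injective _≡_ _≡_ nb → (∀ i → Edge G v (nb i)) →
         (φ : Fin (n G) → Fin k) →
         (∀ u w → u ≢ v → w ≢ v → Edge G u w → φ u ≢ φ w) →
         (∀ i → φ (nb i) ≡ i) →
         (r : ℕ) → 3 ≤ r → r ≤ k → (c : Fin r → Fin k) → Injective _≡_ _≡_ c →
         (j : Fin r) → DiPath (SigmaArc G v φ c) (nb (c j)) (nb (c (cprev j)))
lemma1 k _ G (_ , ¬colorable , _) _ v deg-v nb nb-injective nb-adj φ φ-proper φ-nb r 3≤r _ =
  sigma-path G ¬colorable v deg-v nb nb-injective nb-adj φ φ-proper φ-nb (≤-trans (n≤1+n 2) 3≤r)
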